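{- Let $R=\mathbb{Z}_n$ with $n=p_1p_2\cdots p_k$ a product of distinct primes. Then for any two distinct vertices $\hat I,\hat J$ of $\mathcal{E}_R$: (1) $d(\hat I,\hat J)=2$ if and only if $\hat I+\hat J\ne R$ and $\hat I\cap\hat J\neq 0$; (2) $d(\hat I,\hat J)=3$ if and only if $\hat I+\hat J\ne R$ and $\hat I\cap \hat J=0$.
   Context: An ideal of a commutative ring $R$ with unity is essential if it has nonzero intersection with every nonzero ideal of $R$. The essential ideal graph $\mathcal{E}_{R}$ is the simple graph whose vertices are the nonzero proper ideals of $R$, distinct $\hat I,\hat J$ adjacent iff $\hat I+\hat J$ is essential. $d$ denotes the graph distance in $\mathcal{E}_R$. -}

module Defs where

open import Data.Nat using (ℕ; zero; suc; _+_; _*_; _∸_; _<_)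
open import Data.Nat.DivMod using (_mod_)
open import Data.Nat.Primality using (Prime)
open import Data.Fin using (Fin; toℕ)
open import Data.Fin.Subset using (Subset; _∈_; _∉_)
open import Data.List using (List)
open import Data.Nat.ListAction using (product)
open import Data.List.Relation.Unary.All using (All)
open import Data.List.Relation.Unary.Unique.Propositional using (Unique)
open import Data.Product using (Σ; ∃; _×_)
open import Relation.Binary.PropositionalEquality using (_≡_; _≢_)
open import Relation.Nullary using (¬_)

SquarefreeProduct : ℕ → Set
SquarefreeProduct n = Σ (List ℕ) λ ps → All Prime ps × Unique ps × n ≡ product ps

-- The ring ℤ_n, carrier Fin n (representatives 0 … n-1)

_+ₙ_ : {n : ℕ} → Fin n → Fin n → Fin n
_+ₙ_ {suc m} a b = (toℕ a + toℕ b) mod suc m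

_*ₙ_ : {n : ℕ} → Fin n → Fin n → Fin n
_*ₙ_ {suc m} a b = (toℕ a * toℕ b) mod suc m

-ₙ_ : {n : ℕ} → Fin n → Fin n
-ₙ_ {suc m} a = (suc m ∸ toℕ a) mod suc m

IsZero : {n : ℕ} → Fin n → Set
IsZero x = toℕ x ≡ 0

record IsIdeal {n : ℕ} (I : Subset n) : Set where
  field
    zero∈ : ∀ x → IsZero x → x ∈ I
    +-closed : ∀ a b → a ∈ I → b ∈ I → (a +ₙ b) ∈ I
    neg-closed : ∀ a → a ∈ I → (-ₙ a) ∈ I
    *-closed : ∀ r a → a ∈ I → (r *ₙ a) ∈ I

NonzeroIdeal : {n : ℕ} → Subset n → Set
NonzeroIdeal I = ∃ λ x → x ∈ I × ¬ IsZero x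

ProperIdeal : {n : ℕ} → Subset n → Set
ProperIdeal I = ¬ (∀ x → x ∈ I)

Vertex : {n : ℕ} → Subset n → Set
Vertex I = IsIdeal I × NonzeroIdeal I × ProperIdeal I

InSum : {n : ℕ} → Subset n → Subset n → Fin n → Set
InSum I J x = ∃ λ a → ∃ λ b → a ∈ I × b ∈ J × (a +ₙ b) ≡ x

Essential : {n : ℕ} → (Fin n → Set) → Set
Essential {n} S = (K : Subset n) → IsIdeal K → NonzeroIdeal K →
  ∃ λ x → S x × x ∈ K × ¬ IsZero x

Adj : {n : ℕ} → Subset n → Subset n → Set
Adj I J = I ≢ J × Essential (InSum I J)

data Walk {n : ℕ} : Subset n → Subset n → ℕ → Set where
  here : ∀ {I} → Walk I I 0
  step : ∀ {I K J k} → Vertex K → Adj I K → Walk K J k → Walk I J (suc k)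

Dist : {n : ℕ} → Subset n → Subset n → ℕ → Set
Dist I J k = Walk I J k × (∀ m → m < k → ¬ Walk I J m)

SumIsWhole : {n : ℕ} → Subset n → Subset n → Set
SumIsWhole I J = ∀ x → InSum I J x

IntersectionNonzero : {n : ℕ} → Subset n → Subset n → Set
IntersectionNonzero I J = ∃ λ x → x ∈ I × x ∈ J × ¬ IsZero x

IntersectionZero : {n : ℕ} → Subset n → Subset n → Set
IntersectionZero I J = ∀ x → x ∈ I → x ∈ J → IsZero x

-- In ℤₙ with n squarefree every x is von Neumann regular (x = x²y for some y): if a represents x,
-- then a is coprime to n / gcd(a, n), and Bézout gives y. Hence every ideal I contains an
-- idempotent unit e with ex = x on I. For ideals with units e and f, I + J = ℤₙ iff
-- (1-e)(1-f) = 0, and I ∩ J = 0 iff ef = 0. A proper sum I + J is never essential, since it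
-- meets the nonzero ideal (1-e)(1-f)ℤₙ only in 0; so adjacency means I + J = ℤₙ.
-- If I ∩ J ≠ 0, the ideal (1-ef)ℤₙ is a common neighbour of I and J. If I ∩ J = 0 there is no
-- common neighbour, but I, (1-e)ℤₙ, (1-f)ℤₙ, J is a path.
module Submission where

open import Defs
open import Level using (0ℓ; _⊔_)
open import Function using (_∘_; id)
open import Function.Bundles using (_⇔_; mk⇔; Equivalence)
open import Data.Nat as ℕ using (ℕ; zero; suc; _∸_)
import Data.Nat.Properties as ℕ
open import Data.Nat.DivMod using (_mod_; _%_; %-distribˡ-+; %-distribˡ-*; m<n⇒m%n≡m; n%n≡0; [m+kn]%n≡m%n; m*n%n≡0)
open import Data.Nat.Divisibility using (_∣_; _∣?_; divides; ∣-trans; m∣m*n; ∣1⇒≡1; *-pres-∣; *-cancelˡ-∣)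
open import Data.Nat.GCD using (gcd; gcd[m,n]∣m; gcd[m,n]∣n; gcd-greatest; module Bézout)
open import Data.Nat.Coprimality using (Coprime; coprime-Bézout; coprime-divisor)
open import Data.Nat.Primality using (Prime; euclidsLemma; prime⇒irreducible; prime⇒nonZero; productOfPrimes≢0)
open import Data.Nat.Primality.Factorisation using (factorisationHasAllPrimeFactors)
open import Data.Nat.ListAction using (product)
open import Data.Nat.Tactic.RingSolver using (solve-∀)
open import Data.Fin using (Fin; toℕ; _≟_)
open import Data.Fin.Properties using (toℕ-fromℕ<; toℕ-injective; toℕ<n)
open import Data.Fin.Subset using (Subset; _∈_)
open import Data.Fin.Subset.Properties using (_∈?_)
open import Data.Vec using (tabulate)
open import Data.Vec.Properties using (lookup∘tabulate; lookup⇒[]=; []=⇒lookup)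
open import Data.List using (List; []; _∷_; allFin)
open import Data.List.Membership.Propositional.Properties using (∈-allFin)
open import Data.List.Relation.Unary.All as All using (All; []; _∷_)
open import Data.List.Relation.Unary.All.Properties using (All¬⇒¬Any)
open import Data.List.Relation.Unary.AllPairs using ([]; _∷_)
open import Data.List.Relation.Unary.Unique.Propositional using (Unique)
open import Data.Product using (∃; _×_; _,_; proj₁; proj₂)
open import Data.Sum using (_⊎_; inj₁; inj₂; [_,_]′)
open import Algebra.Bundles using (CommutativeRing)
open import Algebra.Structures using (IsCommutativeRing)
import Algebra.Properties.Ring as RingProperties
import Algebra.Properties.CommutativeSemigroup as CommutativeSemigroupProperties
open import Relation.Nullary using (¬_; Dec; yes; no; does; contradiction)
open import Relation.Nullary.Decidable using (dec-true; decidable-stable)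
open import Relation.Binary.PropositionalEquality
  using (_≡_; _≢_; refl; sym; trans; cong; cong₂; subst; isEquivalence; module ≡-Reasoning)
import Relation.Binary.Reasoning.Setoid as SetoidReasoning

module Idempotents {c ℓ} (R : CommutativeRing c ℓ) where

  open CommutativeRing R renaming (trans to ≈-trans)
  open RingProperties ring using (-‿distribʳ-*; -‿involutive; [y-z]x≈yx-zx; -0#≈0#; +-inverseˡ-unique)
  open CommutativeSemigroupProperties *-commutativeSemigroup using (interchange; xy∙z≈y∙xz)
  open SetoidReasoning setoid

  infix 9 _ᶜ
  _ᶜ : Carrier → Carrier
  e ᶜ = 1# - e

  IsIdempotent : Carrier → Set ℓ
  IsIdempotent e = e * e ≈ e

  IsRegular : Set (c ⊔ ℓ)
  IsRegular = ∀ x → ∃ λ y → x * x * y ≈ x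

  x+xᶜ≈1 : ∀ x → x + x ᶜ ≈ 1#
  x+xᶜ≈1 x = begin
    x + (1# - x)   ≈⟨ +-congˡ (+-comm 1# (- x)) ⟩
    x + (- x + 1#) ≈⟨ +-assoc x (- x) 1# ⟨
    (x - x) + 1#   ≈⟨ +-congʳ (-‿inverseʳ x) ⟩
    0# + 1#        ≈⟨ +-identityˡ 1# ⟩
    1#             ∎

  ᶜ-involutive : ∀ x → x ᶜ ᶜ ≈ x
  ᶜ-involutive x = begin
    1# - (1# - x)                  ≈⟨ +-congʳ (x+xᶜ≈1 x) ⟨
    (x + (1# - x)) - (1# - x)      ≈⟨ +-assoc x (1# - x) (- (1# - x)) ⟩
    x + ((1# - x) - (1# - x))      ≈⟨ +-congˡ (-‿inverseʳ (1# - x)) ⟩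
    x + 0#                         ≈⟨ +-identityʳ x ⟩
    x                              ∎

  ᶜ≈0⇒≈1 : ∀ x → x ᶜ ≈ 0# → x ≈ 1#
  ᶜ≈0⇒≈1 x xᶜ≈0 = begin
    x            ≈⟨ ᶜ-involutive x ⟨
    1# - x ᶜ     ≈⟨ +-congˡ (-‿cong xᶜ≈0) ⟩
    1# - 0#      ≈⟨ +-congˡ -0#≈0# ⟩
    1# + 0#      ≈⟨ +-identityʳ 1# ⟩
    1#           ∎

  ᶜ≈1⇒≈0 : ∀ x → x ᶜ ≈ 1# → x ≈ 0#
  ᶜ≈1⇒≈0 x xᶜ≈1 = begin
    x            ≈⟨ ᶜ-involutive x ⟨
    1# - x ᶜ     ≈⟨ +-congˡ (-‿cong xᶜ≈1) ⟩
    1# - 1#      ≈⟨ -‿inverseʳ 1# ⟩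
    0#           ∎

  e*x+eᶜ*x≈x : ∀ e x → e * x + e ᶜ * x ≈ x
  e*x+eᶜ*x≈x e x = begin
    e * x + e ᶜ * x   ≈⟨ distribʳ x e (e ᶜ) ⟨
    (e + e ᶜ) * x     ≈⟨ *-congʳ (x+xᶜ≈1 e) ⟩
    1# * x            ≈⟨ *-identityˡ x ⟩
    x                 ∎

  e*x≈x⇒eᶜ*x≈0 : ∀ e x → e * x ≈ x → e ᶜ * x ≈ 0#
  e*x≈x⇒eᶜ*x≈0 e x ex≈x = begin
    (1# - e) * x      ≈⟨ [y-z]x≈yx-zx x 1# e ⟩
    1# * x - e * x    ≈⟨ +-cong (*-identityˡ x) (-‿cong ex≈x) ⟩
    x - x             ≈⟨ -‿inverseʳ x ⟩
    0#                ∎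

  eᶜ*x≈0⇒e*x≈x : ∀ e x → e ᶜ * x ≈ 0# → e * x ≈ x
  eᶜ*x≈0⇒e*x≈x e x eᶜx≈0 = begin
    e * x             ≈⟨ +-identityʳ (e * x) ⟨
    e * x + 0#        ≈⟨ +-congˡ eᶜx≈0 ⟨
    e * x + e ᶜ * x   ≈⟨ e*x+eᶜ*x≈x e x ⟩
    x                 ∎

  ᶜ*idempotent≈0 : ∀ e → IsIdempotent e → e ᶜ * e ≈ 0#
  ᶜ*idempotent≈0 e = e*x≈x⇒eᶜ*x≈0 e e

  idempotent*ᶜ≈0 : ∀ e → IsIdempotent e → e * e ᶜ ≈ 0#
  idempotent*ᶜ≈0 e e²≈e = ≈-trans (*-comm e (e ᶜ)) (ᶜ*idempotent≈0 e e²≈e)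

  ᶜ-idempotent : ∀ e → IsIdempotent e → IsIdempotent (e ᶜ)
  ᶜ-idempotent e e²≈e =
    eᶜ*x≈0⇒e*x≈x (e ᶜ) (e ᶜ) (≈-trans (*-congʳ (ᶜ-involutive e)) (idempotent*ᶜ≈0 e e²≈e))

  *-idempotent : ∀ e f → IsIdempotent e → IsIdempotent f → IsIdempotent (e * f)
  *-idempotent e f e²≈e f²≈f = ≈-trans (interchange e f e f) (*-cong e²≈e f²≈f)

  x*y+z≈0⇒x*-y≈z : ∀ x y z → x * y + z ≈ 0# → x * - y ≈ z
  x*y+z≈0⇒x*-y≈z x y z xy+z≈0 = begin
    x * - y       ≈⟨ -‿distribʳ-* x y ⟨
    - (x * y)     ≈⟨ -‿cong (+-inverseˡ-unique (x * y) z xy+z≈0) ⟩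
    - - z         ≈⟨ -‿involutive z ⟩
    z             ∎

  eᶜ*fᶜ≈0⇒x≈e*x+eᶜ*[f*x] : ∀ e f x → e ᶜ * f ᶜ ≈ 0# → x ≈ e * x + e ᶜ * (f * x)
  eᶜ*fᶜ≈0⇒x≈e*x+eᶜ*[f*x] e f x eᶜfᶜ≈0 = begin
    x                                         ≈⟨ e*x+eᶜ*x≈x e x ⟨
    e * x + e ᶜ * x                           ≈⟨ +-congˡ (*-congˡ (e*x+eᶜ*x≈x f x)) ⟨
    e * x + e ᶜ * (f * x + f ᶜ * x)           ≈⟨ +-congˡ (distribˡ (e ᶜ) (f * x) (f ᶜ * x)) ⟩
    e * x + (e ᶜ * (f * x) + e ᶜ * (f ᶜ * x)) ≈⟨ +-congˡ (+-congˡ (*-assoc (e ᶜ) (f ᶜ) x)) ⟨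
    e * x + (e ᶜ * (f * x) + e ᶜ * f ᶜ * x)   ≈⟨ +-congˡ (+-congˡ (≈-trans (*-congʳ eᶜfᶜ≈0) (zeroˡ x))) ⟩
    e * x + (e ᶜ * (f * x) + 0#)              ≈⟨ +-congˡ (+-identityʳ (e ᶜ * (f * x))) ⟩
    e * x + e ᶜ * (f * x)                     ∎

  eᶜ*fᶜ-annihilates : ∀ e f a b → e * a ≈ a → f * b ≈ b → e ᶜ * f ᶜ * (a + b) ≈ 0#
  eᶜ*fᶜ-annihilates e f a b ea≈a fb≈b = begin
    e ᶜ * f ᶜ * (a + b)                   ≈⟨ distribˡ (e ᶜ * f ᶜ) a b ⟩
    e ᶜ * f ᶜ * a + e ᶜ * f ᶜ * b         ≈⟨ +-cong (xy∙z≈y∙xz (e ᶜ) (f ᶜ) a) (*-assoc (e ᶜ) (f ᶜ) b) ⟩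
    f ᶜ * (e ᶜ * a) + e ᶜ * (f ᶜ * b)     ≈⟨ +-cong (*-congˡ (e*x≈x⇒eᶜ*x≈0 e a ea≈a)) (*-congˡ (e*x≈x⇒eᶜ*x≈0 f b fb≈b)) ⟩
    f ᶜ * 0# + e ᶜ * 0#                   ≈⟨ +-cong (zeroʳ (f ᶜ)) (zeroʳ (e ᶜ)) ⟩
    0# + 0#                               ≈⟨ +-identityʳ 0# ⟩
    0#                                    ∎

  e*x≈x⇒[e+eᶜ*f]*x≈x : ∀ e f x → e * x ≈ x → (e + e ᶜ * f) * x ≈ x
  e*x≈x⇒[e+eᶜ*f]*x≈x e f x ex≈x = begin
    (e + e ᶜ * f) * x      ≈⟨ distribʳ x e (e ᶜ * f) ⟩
    e * x + e ᶜ * f * x    ≈⟨ +-cong ex≈x (xy∙z≈y∙xz (e ᶜ) f x) ⟩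
    x + f * (e ᶜ * x)      ≈⟨ +-congˡ (≈-trans (*-congˡ (e*x≈x⇒eᶜ*x≈0 e x ex≈x)) (zeroʳ f)) ⟩
    x + 0#                 ≈⟨ +-identityʳ x ⟩
    x                      ∎

  f*x≈x⇒[e+eᶜ*f]*x≈x : ∀ e f x → f * x ≈ x → (e + e ᶜ * f) * x ≈ x
  f*x≈x⇒[e+eᶜ*f]*x≈x e f x fx≈x = begin
    (e + e ᶜ * f) * x      ≈⟨ distribʳ x e (e ᶜ * f) ⟩
    e * x + e ᶜ * f * x    ≈⟨ +-congˡ (≈-trans (*-assoc (e ᶜ) f x) (*-congˡ fx≈x)) ⟩
    e * x + e ᶜ * x        ≈⟨ e*x+eᶜ*x≈x e x ⟩
    x                      ∎

  x*x*y≈x⇒y*x*x≈x : ∀ x y → x * x * y ≈ x → y * x * x ≈ x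
  x*x*y≈x⇒y*x*x≈x x y x²y≈x = ≈-trans (*-assoc y x x) (≈-trans (*-comm y (x * x)) x²y≈x)

  e*x≈x⇒f*x≈x⇒e*f≈0⇒x≈0 : ∀ e f x → e * x ≈ x → f * x ≈ x → e * f ≈ 0# → x ≈ 0#
  e*x≈x⇒f*x≈x⇒e*f≈0⇒x≈0 e f x ex≈x fx≈x ef≈0 = begin
    x             ≈⟨ ex≈x ⟨
    e * x         ≈⟨ *-congˡ fx≈x ⟨
    e * (f * x)   ≈⟨ *-assoc e f x ⟨
    e * f * x     ≈⟨ *-congʳ ef≈0 ⟩
    0# * x        ≈⟨ zeroˡ x ⟩
    0#            ∎

open ≡-Reasoning

SquareFree : ℕ → Set
SquareFree n = ∀ i → i ℕ.* i ∣ n → i ≡ 1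

product-squareFree : ∀ {ps} → All Prime ps → Unique ps → SquareFree (product ps)
product-squareFree {[]} [] [] i i²∣1 = ∣1⇒≡1 (∣-trans (m∣m*n i) i²∣1)
product-squareFree {q ∷ qs} (q-prime ∷ qs-prime) (q∉qs ∷ qs-unique) i i²∣qP with q ∣? i
... | yes q∣i = contradiction (factorisationHasAllPrimeFactors q-prime q∣P qs-prime) (All¬⇒¬Any q∉qs)
  where
  instance
    q≢0 : ℕ.NonZero q
    q≢0 = prime⇒nonZero q-prime
  q∣P : q ∣ product qs
  q∣P = *-cancelˡ-∣ q (∣-trans (*-pres-∣ q∣i q∣i) i²∣qP)
... | no q∤i = product-squareFree qs-prime qs-unique i (coprime-divisor i²⊥q i²∣qP)
  where
  i²⊥q : Coprime (i ℕ.* i) q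
  i²⊥q (d∣i² , d∣q) with prime⇒irreducible q-prime d∣q
  ... | inj₁ d≡1 = d≡1
  ... | inj₂ refl = contradiction (euclidsLemma i i q-prime d∣i²) [ q∤i , q∤i ]′

squareFree⇒coprime-cofactor : ∀ {a n n′} → SquareFree n → n ≡ n′ ℕ.* gcd a n → Coprime a n′
squareFree⇒coprime-cofactor {a} {n} {n′} sf n≡n′g {i} (i∣a , i∣n′) =
  sf i (subst (i ℕ.* i ∣_) (sym n≡n′g) (*-pres-∣ i∣n′ i∣g))
  where
  i∣g : i ∣ gcd a n
  i∣g = gcd-greatest i∣a (∣-trans i∣n′ (subst (n′ ∣_) (sym n≡n′g) (m∣m*n (gcd a n))))

bézout⁺⇒a*a*u≡a+k*n : ∀ {a a′ g n n′ u v} → a ≡ a′ ℕ.* g → n ≡ n′ ℕ.* g →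
  1 ℕ.+ v ℕ.* n′ ≡ u ℕ.* a → a ℕ.* a ℕ.* u ≡ a ℕ.+ (a′ ℕ.* v) ℕ.* n
bézout⁺⇒a*a*u≡a+k*n {_} {a′} {g} {_} {n′} {u} {v} refl refl eq = begin
  a ℕ.* a ℕ.* u                 ≡⟨ ℕ.*-assoc a a u ⟩
  a ℕ.* (a ℕ.* u)               ≡⟨ cong (a ℕ.*_) (ℕ.*-comm a u) ⟩
  a ℕ.* (u ℕ.* a)               ≡⟨ cong (a ℕ.*_) eq ⟨
  a ℕ.* (1 ℕ.+ v ℕ.* n′)        ≡⟨ expand a′ g v n′ ⟩
  a ℕ.+ (a′ ℕ.* v) ℕ.* (n′ ℕ.* g) ∎
  where
  a : ℕ
  a = a′ ℕ.* g
  expand : ∀ a′ g v n′ → (a′ ℕ.* g) ℕ.* (1 ℕ.+ v ℕ.* n′) ≡ a′ ℕ.* g ℕ.+ (a′ ℕ.* v) ℕ.* (n′ ℕ.* g)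
  expand = solve-∀

bézout⁻⇒a*a*u+a≡k*n : ∀ {a a′ g n n′ u v} → a ≡ a′ ℕ.* g → n ≡ n′ ℕ.* g →
  1 ℕ.+ u ℕ.* a ≡ v ℕ.* n′ → a ℕ.* a ℕ.* u ℕ.+ a ≡ (a′ ℕ.* v) ℕ.* n
bézout⁻⇒a*a*u+a≡k*n {_} {a′} {g} {_} {n′} {u} {v} refl refl eq = begin
  a ℕ.* a ℕ.* u ℕ.+ a           ≡⟨ factor a u ⟩
  a ℕ.* (1 ℕ.+ u ℕ.* a)         ≡⟨ cong (a ℕ.*_) eq ⟩
  a ℕ.* (v ℕ.* n′)              ≡⟨ regroup a′ g v n′ ⟩
  (a′ ℕ.* v) ℕ.* (n′ ℕ.* g)     ∎
  where
  a : ℕ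
  a = a′ ℕ.* g
  factor : ∀ a u → a ℕ.* a ℕ.* u ℕ.+ a ≡ a ℕ.* (1 ℕ.+ u ℕ.* a)
  factor = solve-∀
  regroup : ∀ a′ g v n′ → (a′ ℕ.* g) ℕ.* (v ℕ.* n′) ≡ (a′ ℕ.* v) ℕ.* (n′ ℕ.* g)
  regroup = solve-∀

module Modular (m : ℕ) where

  n : ℕ
  n = suc m

  [_] : ℕ → Fin n
  [ a ] = a mod n

  toℕ-[] : ∀ a → toℕ [ a ] ≡ a % n
  toℕ-[] a = toℕ-fromℕ< _

  []-cong : ∀ {a b} → a % n ≡ b % n → [ a ] ≡ [ b ]
  []-cong {a} {b} eq = toℕ-injective (trans (toℕ-[] a) (trans eq (sym (toℕ-[] b))))

  []-toℕ : ∀ x → [ toℕ x ] ≡ x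
  []-toℕ x = toℕ-injective (trans (toℕ-[] (toℕ x)) (m<n⇒m%n≡m (toℕ<n x)))

  []-+ : ∀ a b → [ a ] +ₙ [ b ] ≡ [ a ℕ.+ b ]
  []-+ a b = []-cong {toℕ [ a ] ℕ.+ toℕ [ b ]} {a ℕ.+ b} (begin
    (toℕ [ a ] ℕ.+ toℕ [ b ]) % n ≡⟨ cong₂ (λ u v → (u ℕ.+ v) % n) (toℕ-[] a) (toℕ-[] b) ⟩
    ((a % n) ℕ.+ (b % n)) % n     ≡⟨ %-distribˡ-+ a b n ⟨
    (a ℕ.+ b) % n                 ∎)

  []-* : ∀ a b → [ a ] *ₙ [ b ] ≡ [ a ℕ.* b ]
  []-* a b = []-cong {toℕ [ a ] ℕ.* toℕ [ b ]} {a ℕ.* b} (begin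
    (toℕ [ a ] ℕ.* toℕ [ b ]) % n ≡⟨ cong₂ (λ u v → (u ℕ.* v) % n) (toℕ-[] a) (toℕ-[] b) ⟩
    ((a % n) ℕ.* (b % n)) % n     ≡⟨ %-distribˡ-* a b n ⟨
    (a ℕ.* b) % n                 ∎)

  +-assoc : ∀ x y z → (x +ₙ y) +ₙ z ≡ x +ₙ (y +ₙ z)
  +-assoc x y z = begin
    (x +ₙ y) +ₙ z                         ≡⟨ cong ((x +ₙ y) +ₙ_) ([]-toℕ z) ⟨
    [ toℕ x ℕ.+ toℕ y ] +ₙ [ toℕ z ]      ≡⟨ []-+ (toℕ x ℕ.+ toℕ y) (toℕ z) ⟩
    [ toℕ x ℕ.+ toℕ y ℕ.+ toℕ z ]         ≡⟨ cong [_] (ℕ.+-assoc (toℕ x) _ _) ⟩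
    [ toℕ x ℕ.+ (toℕ y ℕ.+ toℕ z) ]       ≡⟨ []-+ (toℕ x) (toℕ y ℕ.+ toℕ z) ⟨
    [ toℕ x ] +ₙ [ toℕ y ℕ.+ toℕ z ]      ≡⟨ cong (_+ₙ (y +ₙ z)) ([]-toℕ x) ⟩
    x +ₙ (y +ₙ z)                         ∎

  *-assoc : ∀ x y z → (x *ₙ y) *ₙ z ≡ x *ₙ (y *ₙ z)
  *-assoc x y z = begin
    (x *ₙ y) *ₙ z                         ≡⟨ cong ((x *ₙ y) *ₙ_) ([]-toℕ z) ⟨
    [ toℕ x ℕ.* toℕ y ] *ₙ [ toℕ z ]      ≡⟨ []-* (toℕ x ℕ.* toℕ y) (toℕ z) ⟩
    [ toℕ x ℕ.* toℕ y ℕ.* toℕ z ]         ≡⟨ cong [_] (ℕ.*-assoc (toℕ x) _ _) ⟩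
    [ toℕ x ℕ.* (toℕ y ℕ.* toℕ z) ]       ≡⟨ []-* (toℕ x) (toℕ y ℕ.* toℕ z) ⟨
    [ toℕ x ] *ₙ [ toℕ y ℕ.* toℕ z ]      ≡⟨ cong (_*ₙ (y *ₙ z)) ([]-toℕ x) ⟩
    x *ₙ (y *ₙ z)                         ∎

  +-comm : ∀ x y → x +ₙ y ≡ y +ₙ x
  +-comm x y = cong [_] (ℕ.+-comm (toℕ x) (toℕ y))

  *-comm : ∀ x y → x *ₙ y ≡ y *ₙ x
  *-comm x y = cong [_] (ℕ.*-comm (toℕ x) (toℕ y))

  +-identityˡ : ∀ x → [ 0 ] +ₙ x ≡ x
  +-identityˡ x = []-toℕ x

  *-identityˡ : ∀ x → [ 1 ] *ₙ x ≡ x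
  *-identityˡ x = begin
    [ 1 ] *ₙ x              ≡⟨ cong ([ 1 ] *ₙ_) ([]-toℕ x) ⟨
    [ 1 ] *ₙ [ toℕ x ]      ≡⟨ []-* 1 (toℕ x) ⟩
    [ 1 ℕ.* toℕ x ]         ≡⟨ cong [_] (ℕ.*-identityˡ (toℕ x)) ⟩
    [ toℕ x ]               ≡⟨ []-toℕ x ⟩
    x                       ∎

  -‿inverseˡ : ∀ x → (-ₙ x) +ₙ x ≡ [ 0 ]
  -‿inverseˡ x = begin
    [ n ∸ toℕ x ] +ₙ x              ≡⟨ cong ([ n ∸ toℕ x ] +ₙ_) ([]-toℕ x) ⟨
    [ n ∸ toℕ x ] +ₙ [ toℕ x ]      ≡⟨ []-+ (n ∸ toℕ x) (toℕ x) ⟩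
    [ n ∸ toℕ x ℕ.+ toℕ x ]         ≡⟨ cong [_] (ℕ.m∸n+n≡m (ℕ.<⇒≤ (toℕ<n x))) ⟩
    [ n ]                           ≡⟨ []-cong {n} {0} (n%n≡0 n) ⟩
    [ 0 ]                           ∎

  *-distribˡ-+ : ∀ x y z → x *ₙ (y +ₙ z) ≡ (x *ₙ y) +ₙ (x *ₙ z)
  *-distribˡ-+ x y z = begin
    x *ₙ (y +ₙ z)                               ≡⟨ cong (_*ₙ (y +ₙ z)) ([]-toℕ x) ⟨
    [ toℕ x ] *ₙ [ toℕ y ℕ.+ toℕ z ]            ≡⟨ []-* (toℕ x) (toℕ y ℕ.+ toℕ z) ⟩
    [ toℕ x ℕ.* (toℕ y ℕ.+ toℕ z) ]             ≡⟨ cong [_] (ℕ.*-distribˡ-+ (toℕ x) (toℕ y) (toℕ z)) ⟩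
    [ toℕ x ℕ.* toℕ y ℕ.+ toℕ x ℕ.* toℕ z ]     ≡⟨ []-+ (toℕ x ℕ.* toℕ y) (toℕ x ℕ.* toℕ z) ⟨
    (x *ₙ y) +ₙ (x *ₙ z)                        ∎

  isCommutativeRing : IsCommutativeRing _≡_ _+ₙ_ _*ₙ_ -ₙ_ [ 0 ] [ 1 ]
  isCommutativeRing = record
    { isRing = record
      { +-isAbelianGroup = record
        { isGroup = record
          { isMonoid = record
            { isSemigroup = record
              { isMagma = record { isEquivalence = isEquivalence ; ∙-cong = cong₂ _+ₙ_ }
              ; assoc   = +-assoc
              }
            ; identity = +-identityˡ , λ x → trans (+-comm x [ 0 ]) (+-identityˡ x)
            }
          ; inverse = -‿inverseˡ , λ x → trans (+-comm x (-ₙ x)) (-‿inverseˡ x)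
          ; ⁻¹-cong = cong -ₙ_
          }
        ; comm = +-comm
        }
      ; *-cong     = cong₂ _*ₙ_
      ; *-assoc    = *-assoc
      ; *-identity = *-identityˡ , λ x → trans (*-comm x [ 1 ]) (*-identityˡ x)
      ; distrib    = *-distribˡ-+ , λ x y z → begin
          (y +ₙ z) *ₙ x          ≡⟨ *-comm (y +ₙ z) x ⟩
          x *ₙ (y +ₙ z)          ≡⟨ *-distribˡ-+ x y z ⟩
          (x *ₙ y) +ₙ (x *ₙ z)   ≡⟨ cong₂ _+ₙ_ (*-comm x y) (*-comm x z) ⟩
          (y *ₙ x) +ₙ (z *ₙ x)   ∎
      }
    ; *-comm = *-comm
    }

  commutativeRing : CommutativeRing 0ℓ 0ℓ
  commutativeRing = record { isCommutativeRing = isCommutativeRing }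

  open Idempotents commutativeRing using (IsRegular; x*y+z≈0⇒x*-y≈z)

  [a+kn]≡[a] : ∀ a k → [ a ℕ.+ k ℕ.* n ] ≡ [ a ]
  [a+kn]≡[a] a k = []-cong {a ℕ.+ k ℕ.* n} {a} ([m+kn]%n≡m%n a k n)

  [kn]≡[0] : ∀ k → [ k ℕ.* n ] ≡ [ 0 ]
  [kn]≡[0] k = []-cong {k ℕ.* n} {0} (m*n%n≡0 k n)

  bézout⇒regular : ∀ x {a′ g n′} → toℕ x ≡ a′ ℕ.* g → n ≡ n′ ℕ.* g →
    Bézout.Identity 1 (toℕ x) n′ → ∃ λ y → (x *ₙ x) *ₙ y ≡ x
  bézout⇒regular x {a′} {g} {n′} a≡a′g n≡n′g (Bézout.+- u v eq) = [ u ] , (begin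
    (x *ₙ x) *ₙ [ u ]                 ≡⟨ []-* (a ℕ.* a) u ⟩
    [ a ℕ.* a ℕ.* u ]                 ≡⟨ cong [_] (bézout⁺⇒a*a*u≡a+k*n {a} {a′} {g} {n} {n′} a≡a′g n≡n′g eq) ⟩
    [ a ℕ.+ (a′ ℕ.* v) ℕ.* n ]        ≡⟨ [a+kn]≡[a] a (a′ ℕ.* v) ⟩
    [ a ]                             ≡⟨ []-toℕ x ⟩
    x                                 ∎)
    where
    a : ℕ
    a = toℕ x
  bézout⇒regular x {a′} {g} {n′} a≡a′g n≡n′g (Bézout.-+ u v eq) =
    -ₙ [ u ] , x*y+z≈0⇒x*-y≈z (x *ₙ x) [ u ] x (begin
    ((x *ₙ x) *ₙ [ u ]) +ₙ x          ≡⟨ cong₂ _+ₙ_ ([]-* (a ℕ.* a) u) (sym ([]-toℕ x)) ⟩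
    [ a ℕ.* a ℕ.* u ] +ₙ [ a ]        ≡⟨ []-+ (a ℕ.* a ℕ.* u) a ⟩
    [ a ℕ.* a ℕ.* u ℕ.+ a ]           ≡⟨ cong [_] (bézout⁻⇒a*a*u+a≡k*n {a} {a′} {g} {n} {n′} a≡a′g n≡n′g eq) ⟩
    [ (a′ ℕ.* v) ℕ.* n ]              ≡⟨ [kn]≡[0] (a′ ℕ.* v) ⟩
    [ 0 ]                             ∎)
    where
    a : ℕ
    a = toℕ x

  squareFree⇒regular : SquareFree n → IsRegular
  squareFree⇒regular sf x with gcd[m,n]∣m (toℕ x) n | gcd[m,n]∣n (toℕ x) n
  ... | divides a′ a≡a′g | divides n′ n≡n′g =
    bézout⇒regular x {a′} {gcd (toℕ x) n} {n′} a≡a′g n≡n′g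
      (coprime-Bézout (squareFree⇒coprime-cofactor {toℕ x} {n} sf n≡n′g))

module IdealGraph (m : ℕ) where

  open Modular m using (n; commutativeRing)
  open CommutativeRing commutativeRing
    using (_+_; _*_; 0#; 1#; *-identityʳ; *-comm; *-assoc; zeroˡ; zeroʳ; distribˡ)
  open Idempotents commutativeRing
  open RingProperties (CommutativeRing.ring commutativeRing) using (-‿distribʳ-*)
  open CommutativeSemigroupProperties (CommutativeRing.*-commutativeSemigroup commutativeRing) using (x∙yz≈y∙xz)

  private variable
    I J K : Subset n

  isZero⇒≡0 : ∀ {x} → IsZero x → x ≡ 0#
  isZero⇒≡0 = toℕ-injective

  *-closedʳ : IsIdeal I → ∀ a r → a ∈ I → a * r ∈ I
  *-closedʳ {I} idI a r a∈I = subst (_∈ I) (*-comm r a) (IsIdeal.*-closed idI r a a∈I)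

  1∈⇒whole : IsIdeal I → 1# ∈ I → ∀ x → x ∈ I
  1∈⇒whole {I} idI 1∈I x = subst (_∈ I) (*-identityʳ x) (IsIdeal.*-closed idI x 1# 1∈I)

  proper⇒¬sumIsWhole-self : IsIdeal I → ProperIdeal I → ¬ SumIsWhole I I
  proper⇒¬sumIsWhole-self {I} idI proper whole = proper λ x →
    let (a , b , a∈I , b∈I , a+b≡x) = whole x
    in  subst (_∈ I) a+b≡x (IsIdeal.+-closed idI a b a∈I b∈I)

  -- Such an e is the idempotent generator of I, i.e. I = eℤₙ.
  IsUnitOf : Subset n → Fin n → Set
  IsUnitOf I e = e ∈ I × (∀ x → x ∈ I → e * x ≡ x)

  unit-idempotent : ∀ {e} → IsUnitOf I e → IsIdempotent e
  unit-idempotent (e∈I , unit) = unit _ e∈I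

  vertex-unit≢0 : ∀ {e} → Vertex I → IsUnitOf I e → e ≢ 0#
  vertex-unit≢0 (_ , (x , x∈I , x≢0) , _) (_ , unit) e≡0 =
    x≢0 (cong toℕ (trans (sym (unit x x∈I)) (trans (cong (_* x) e≡0) (zeroˡ x))))

  vertex-unit≢1 : ∀ {e} → Vertex I → IsUnitOf I e → e ≢ 1#
  vertex-unit≢1 {I} (idI , _ , proper) (e∈I , _) e≡1 = proper (1∈⇒whole idI (subst (_∈ I) e≡1 e∈I))

  -- For idempotent e this is the principal ideal eℤₙ, cut out by the decidable test e * x ≟ x.
  ⟨_⟩ : Fin n → Subset n
  ⟨ e ⟩ = tabulate λ x → does (e * x ≟ x)

  ∈⟨⟩⁺ : ∀ e {x} → e * x ≡ x → x ∈ ⟨ e ⟩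
  ∈⟨⟩⁺ e {x} ex≡x =
    lookup⇒[]= x ⟨ e ⟩ (trans (lookup∘tabulate (λ y → does (e * y ≟ y)) x) (dec-true (e * x ≟ x) ex≡x))

  ∈⟨⟩⁻ : ∀ e {x} → x ∈ ⟨ e ⟩ → e * x ≡ x
  ∈⟨⟩⁻ e {x} x∈ with e * x ≟ x | trans (sym (lookup∘tabulate (λ y → does (e * y ≟ y)) x)) ([]=⇒lookup x∈)
  ... | yes ex≡x | _  = ex≡x
  ... | no  _    | ()

  ⟨⟩-isIdeal : ∀ e → IsIdeal ⟨ e ⟩
  ⟨⟩-isIdeal e = record
    { zero∈      = λ x x≡0 → ∈⟨⟩⁺ e (trans (cong (e *_) (isZero⇒≡0 x≡0)) (trans (zeroʳ e) (sym (isZero⇒≡0 x≡0))))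
    ; +-closed   = λ a b a∈ b∈ → ∈⟨⟩⁺ e (trans (distribˡ e a b) (cong₂ _+_ (∈⟨⟩⁻ e a∈) (∈⟨⟩⁻ e b∈)))
    ; neg-closed = λ a a∈ → ∈⟨⟩⁺ e (trans (sym (-‿distribʳ-* e a)) (cong -ₙ_ (∈⟨⟩⁻ e a∈)))
    ; *-closed   = λ r a a∈ → ∈⟨⟩⁺ e (trans (x∙yz≈y∙xz e r a) (cong (r *_) (∈⟨⟩⁻ e a∈)))
    }

  ⟨⟩-unit : ∀ {e} → IsIdempotent e → IsUnitOf ⟨ e ⟩ e
  ⟨⟩-unit {e} e²≡e = ∈⟨⟩⁺ e e²≡e , λ _ → ∈⟨⟩⁻ e

  ⟨⟩-vertex : ∀ {e} → IsIdempotent e → e ≢ 0# → e ≢ 1# → Vertex ⟨ e ⟩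
  ⟨⟩-vertex {e} e²≡e e≢0 e≢1 =
    ⟨⟩-isIdeal e , (e , ∈⟨⟩⁺ e e²≡e , e≢0 ∘ isZero⇒≡0) ,
    λ whole → e≢1 (trans (sym (*-identityʳ e)) (∈⟨⟩⁻ e (whole 1#)))

  sumIsWhole⇔ : ∀ {e f} → IsIdeal I → IsIdeal J → IsUnitOf I e → IsUnitOf J f →
    SumIsWhole I J ⇔ (e ᶜ * f ᶜ ≡ 0#)
  sumIsWhole⇔ {I} {J} {e} {f} idI idJ (e∈I , unitI) (f∈J , unitJ) = mk⇔ ⇒ ⇐
    where
    ⇒ : SumIsWhole I J → e ᶜ * f ᶜ ≡ 0#
    ⇒ whole with whole 1#
    ... | a , b , a∈I , b∈J , a+b≡1 = begin
      e ᶜ * f ᶜ              ≡⟨ *-identityʳ (e ᶜ * f ᶜ) ⟨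
      e ᶜ * f ᶜ * 1#         ≡⟨ cong (e ᶜ * f ᶜ *_) a+b≡1 ⟨
      e ᶜ * f ᶜ * (a + b)    ≡⟨ eᶜ*fᶜ-annihilates e f a b (unitI a a∈I) (unitJ b b∈J) ⟩
      0#                     ∎
    ⇐ : e ᶜ * f ᶜ ≡ 0# → SumIsWhole I J
    ⇐ eᶜfᶜ≡0 x = e * x , e ᶜ * (f * x) , *-closedʳ idI e x e∈I ,
      IsIdeal.*-closed idJ (e ᶜ) (f * x) (*-closedʳ idJ f x f∈J) , sym (eᶜ*fᶜ≈0⇒x≈e*x+eᶜ*[f*x] e f x eᶜfᶜ≡0)

  sumIsWhole⇒essential : SumIsWhole I J → Essential (InSum I J)
  sumIsWhole⇒essential whole _ _ (x , x∈K , x≢0) = x , whole x , x∈K , x≢0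

  -- If c = eᶜfᶜ ≠ 0, the nonzero ideal ⟨ c ⟩ meets I + J only in 0, since c annihilates I + J.
  essential⇒ᶜ*ᶜ≡0 : ∀ {e f} → IsUnitOf I e → IsUnitOf J f → Essential (InSum I J) → e ᶜ * f ᶜ ≡ 0#
  essential⇒ᶜ*ᶜ≡0 {e = e} {f = f} uI uJ essential = decidable-stable (c ≟ 0#) λ c≢0 →
    let (x , (a , b , a∈I , b∈J , a+b≡x) , x∈⟨c⟩ , x≢0) =
          essential ⟨ c ⟩ (⟨⟩-isIdeal c) (c , ∈⟨⟩⁺ c c²≡c , c≢0 ∘ isZero⇒≡0)
    in  x≢0 (cong toℕ (begin
          x                  ≡⟨ ∈⟨⟩⁻ c x∈⟨c⟩ ⟨
          c * x              ≡⟨ cong (c *_) a+b≡x ⟨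
          c * (a + b)        ≡⟨ eᶜ*fᶜ-annihilates e f a b (proj₂ uI a a∈I) (proj₂ uJ b b∈J) ⟩
          0#                 ∎))
    where
    c : Fin n
    c = e ᶜ * f ᶜ
    c²≡c : IsIdempotent c
    c²≡c = *-idempotent (e ᶜ) (f ᶜ) (ᶜ-idempotent e (unit-idempotent uI)) (ᶜ-idempotent f (unit-idempotent uJ))

  sumIsWhole⇒adjacent : IsIdeal I → ProperIdeal I → SumIsWhole I J → Adj I J
  sumIsWhole⇒adjacent {I} idI proper whole =
    (λ { refl → proper⇒¬sumIsWhole-self idI proper whole }) , sumIsWhole⇒essential whole

  ᶜ*ᶜ≡0⇒adjacent : ∀ {e f} → Vertex I → IsIdeal J → IsUnitOf I e → IsUnitOf J f →
    e ᶜ * f ᶜ ≡ 0# → Adj I J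
  ᶜ*ᶜ≡0⇒adjacent (idI , _ , proper) idJ uI uJ eᶜfᶜ≡0 =
    sumIsWhole⇒adjacent idI proper (Equivalence.from (sumIsWhole⇔ idI idJ uI uJ) eᶜfᶜ≡0)

  ⟨ᶜ⟩-vertex : ∀ {e} → Vertex I → IsUnitOf I e → Vertex ⟨ e ᶜ ⟩
  ⟨ᶜ⟩-vertex {e = e} vI uI = ⟨⟩-vertex (ᶜ-idempotent e (unit-idempotent uI))
    (vertex-unit≢1 vI uI ∘ ᶜ≈0⇒≈1 e) (vertex-unit≢0 vI uI ∘ ᶜ≈1⇒≈0 e)

  intersectionZero⇔ : ∀ {e f} → IsIdeal I → IsIdeal J → IsUnitOf I e → IsUnitOf J f →
    IntersectionZero I J ⇔ (e * f ≡ 0#)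
  intersectionZero⇔ {e = e} {f = f} idI idJ (e∈I , unitI) (f∈J , unitJ) = mk⇔
    (λ I∩J≡0 → isZero⇒≡0 (I∩J≡0 (e * f) (*-closedʳ idI e f e∈I) (IsIdeal.*-closed idJ e f f∈J)))
    (λ ef≡0 z z∈I z∈J → cong toℕ (e*x≈x⇒f*x≈x⇒e*f≈0⇒x≈0 e f z (unitI z z∈I) (unitJ z z∈J) ef≡0))

  -- A unit e of the elements seen so far and the unit f = yx of xℤₙ combine into the unit e + eᶜf.
  regular⇒unitOn : IsRegular → IsIdeal I → (xs : List (Fin n)) →
    ∃ λ e → e ∈ I × All (λ x → x ∈ I → e * x ≡ x) xs
  regular⇒unitOn _ idI [] = 0# , IsIdeal.zero∈ idI 0# refl , []
  regular⇒unitOn {I} regular idI (x ∷ xs) with regular⇒unitOn regular idI xs | x ∈? I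
  ... | e , e∈I , fixes | no x∉I = e , e∈I , (λ x∈I → contradiction x∈I x∉I) ∷ fixes
  ... | e , e∈I , fixes | yes x∈I = e + e ᶜ * f , e′∈I ,
        (λ _ → f*x≈x⇒[e+eᶜ*f]*x≈x e f x (x*x*y≈x⇒y*x*x≈x x y (proj₂ (regular x)))) ∷
        All.map (λ {z} fixed z∈I → e*x≈x⇒[e+eᶜ*f]*x≈x e f z (fixed z∈I)) fixes
    where
    y f : Fin n
    y = proj₁ (regular x)
    f = y * x
    e′∈I : e + e ᶜ * f ∈ I
    e′∈I = IsIdeal.+-closed idI e (e ᶜ * f) e∈I
             (IsIdeal.*-closed idI (e ᶜ) f (IsIdeal.*-closed idI y x x∈I))

  regular⇒unit : IsRegular → IsIdeal I → ∃ (IsUnitOf I)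
  regular⇒unit regular idI with regular⇒unitOn regular idI (allFin n)
  ... | e , e∈I , fixes = e , e∈I , λ x → All.lookup fixes (∈-allFin x)

  module _ (regular : IsRegular) where

    private
      unitOf : IsIdeal I → Fin n
      unitOf idI = proj₁ (regular⇒unit regular idI)

      isUnitOf : (idI : IsIdeal I) → IsUnitOf I (unitOf idI)
      isUnitOf idI = proj₂ (regular⇒unit regular idI)

    intersectionZero⊎Nonzero : IsIdeal I → IsIdeal J → IntersectionZero I J ⊎ IntersectionNonzero I J
    intersectionZero⊎Nonzero {I} {J} idI idJ = decide (e * f ≟ 0#)
      where
      e f : Fin n
      e = unitOf idI
      f = unitOf idJ
      decide : Dec (e * f ≡ 0#) → IntersectionZero I J ⊎ IntersectionNonzero I J
      decide (yes ef≡0) = inj₁ (Equivalence.from (intersectionZero⇔ idI idJ (isUnitOf idI) (isUnitOf idJ)) ef≡0)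
      decide (no  ef≢0) = inj₂ (e * f , *-closedʳ idI e f (proj₁ (isUnitOf idI)) ,
                                IsIdeal.*-closed idJ e f (proj₁ (isUnitOf idJ)) , ef≢0 ∘ isZero⇒≡0)

    adjacent⇒ᶜ*ᶜ≡0 : (idI : IsIdeal I) (idJ : IsIdeal J) → Adj I J → unitOf idI ᶜ * unitOf idJ ᶜ ≡ 0#
    adjacent⇒ᶜ*ᶜ≡0 idI idJ (_ , essential) = essential⇒ᶜ*ᶜ≡0 (isUnitOf idI) (isUnitOf idJ) essential

    adjacent⇒sumIsWhole : IsIdeal I → IsIdeal J → Adj I J → SumIsWhole I J
    adjacent⇒sumIsWhole idI idJ I~J =
      Equivalence.from (sumIsWhole⇔ idI idJ (isUnitOf idI) (isUnitOf idJ)) (adjacent⇒ᶜ*ᶜ≡0 idI idJ I~J)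

    -- A common neighbour K with unit g would give e(1-g) = 1-g = f(1-g), so 1-g = ef(1-g) = 0.
    intersectionZero⇒¬walk₂ : IsIdeal I → IsIdeal J → IntersectionZero I J → ¬ Walk I J 2
    intersectionZero⇒¬walk₂ idI idJ I∩J≡0 (step {K = K} (idK , _ , properK) I~K (step _ K~J here)) =
      properK (1∈⇒whole idK (subst (_∈ K) (ᶜ≈0⇒≈1 g gᶜ≡0) (proj₁ (isUnitOf idK))))
      where
      e f g : Fin n
      e = unitOf idI
      f = unitOf idJ
      g = unitOf idK
      gᶜ≡0 : g ᶜ ≡ 0#
      gᶜ≡0 = e*x≈x⇒f*x≈x⇒e*f≈0⇒x≈0 e f (g ᶜ)
        (eᶜ*x≈0⇒e*x≈x e (g ᶜ) (adjacent⇒ᶜ*ᶜ≡0 idI idK I~K))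
        (eᶜ*x≈0⇒e*x≈x f (g ᶜ) (trans (*-comm (f ᶜ) (g ᶜ)) (adjacent⇒ᶜ*ᶜ≡0 idK idJ K~J)))
        (Equivalence.to (intersectionZero⇔ idI idJ (isUnitOf idI) (isUnitOf idJ)) I∩J≡0)

    intersectionNonzero⇒walk₂ : Vertex I → Vertex J → IntersectionNonzero I J → Walk I J 2
    intersectionNonzero⇒walk₂ {I} {J} vI@(idI , _ , properI) vJ@(idJ , _) (z , z∈I , z∈J , z≢0) =
      step vK (ᶜ*ᶜ≡0⇒adjacent vI (proj₁ vK) uI uK eᶜkᶜ≡0)
        (step vJ (ᶜ*ᶜ≡0⇒adjacent vK idJ uK uJ kᶜfᶜ≡0) here)
      where
      e f k : Fin n
      e = unitOf idI
      f = unitOf idJ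
      k = (e * f) ᶜ
      uI : IsUnitOf I e
      uI = isUnitOf idI
      uJ : IsUnitOf J f
      uJ = isUnitOf idJ
      k²≡k : IsIdempotent k
      k²≡k = ᶜ-idempotent (e * f) (*-idempotent e f (unit-idempotent uI) (unit-idempotent uJ))
      ef≢1 : e * f ≢ 1#
      ef≢1 ef≡1 = properI (1∈⇒whole idI (subst (_∈ I) ef≡1 (*-closedʳ idI e f (proj₁ uI))))
      ef≢0 : e * f ≢ 0#
      ef≢0 ef≡0 = z≢0 (cong toℕ (e*x≈x⇒f*x≈x⇒e*f≈0⇒x≈0 e f z (proj₂ uI z z∈I) (proj₂ uJ z z∈J) ef≡0))
      vK : Vertex ⟨ k ⟩
      vK = ⟨⟩-vertex k²≡k (ef≢1 ∘ ᶜ≈0⇒≈1 (e * f)) (ef≢0 ∘ ᶜ≈1⇒≈0 (e * f))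
      uK : IsUnitOf ⟨ k ⟩ k
      uK = ⟨⟩-unit k²≡k
      eᶜkᶜ≡0 : e ᶜ * k ᶜ ≡ 0#
      eᶜkᶜ≡0 = begin
        e ᶜ * k ᶜ        ≡⟨ cong (e ᶜ *_) (ᶜ-involutive (e * f)) ⟩
        e ᶜ * (e * f)    ≡⟨ *-assoc (e ᶜ) e f ⟨
        e ᶜ * e * f      ≡⟨ cong (_* f) (ᶜ*idempotent≈0 e (unit-idempotent uI)) ⟩
        0# * f           ≡⟨ zeroˡ f ⟩
        0#               ∎
      kᶜfᶜ≡0 : k ᶜ * f ᶜ ≡ 0#
      kᶜfᶜ≡0 = begin
        k ᶜ * f ᶜ        ≡⟨ cong (_* f ᶜ) (ᶜ-involutive (e * f)) ⟩
        e * f * f ᶜ      ≡⟨ *-assoc e f (f ᶜ) ⟩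
        e * (f * f ᶜ)    ≡⟨ cong (e *_) (idempotent*ᶜ≈0 f (unit-idempotent uJ)) ⟩
        e * 0#           ≡⟨ zeroʳ e ⟩
        0#               ∎

    intersectionZero⇒walk₃ : Vertex I → Vertex J → IntersectionZero I J → Walk I J 3
    intersectionZero⇒walk₃ {I} {J} vI@(idI , _) vJ@(idJ , _) I∩J≡0 =
      step vK₁ (ᶜ*ᶜ≡0⇒adjacent vI (proj₁ vK₁) uI uK₁ eᶜeᶜᶜ≡0)
        (step vK₂ (ᶜ*ᶜ≡0⇒adjacent vK₁ (proj₁ vK₂) uK₁ uK₂ eᶜᶜfᶜᶜ≡0)
          (step vJ (ᶜ*ᶜ≡0⇒adjacent vK₂ idJ uK₂ uJ fᶜᶜfᶜ≡0) here))
      where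
      e f : Fin n
      e = unitOf idI
      f = unitOf idJ
      uI : IsUnitOf I e
      uI = isUnitOf idI
      uJ : IsUnitOf J f
      uJ = isUnitOf idJ
      vK₁ : Vertex ⟨ e ᶜ ⟩
      vK₁ = ⟨ᶜ⟩-vertex vI uI
      vK₂ : Vertex ⟨ f ᶜ ⟩
      vK₂ = ⟨ᶜ⟩-vertex vJ uJ
      uK₁ : IsUnitOf ⟨ e ᶜ ⟩ (e ᶜ)
      uK₁ = ⟨⟩-unit (ᶜ-idempotent e (unit-idempotent uI))
      uK₂ : IsUnitOf ⟨ f ᶜ ⟩ (f ᶜ)
      uK₂ = ⟨⟩-unit (ᶜ-idempotent f (unit-idempotent uJ))
      eᶜeᶜᶜ≡0 : e ᶜ * e ᶜ ᶜ ≡ 0#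
      eᶜeᶜᶜ≡0 = trans (*-comm (e ᶜ) (e ᶜ ᶜ)) (ᶜ*idempotent≈0 (e ᶜ) (ᶜ-idempotent e (unit-idempotent uI)))
      eᶜᶜfᶜᶜ≡0 : e ᶜ ᶜ * f ᶜ ᶜ ≡ 0#
      eᶜᶜfᶜᶜ≡0 = trans (cong₂ _*_ (ᶜ-involutive e) (ᶜ-involutive f))
        (Equivalence.to (intersectionZero⇔ idI idJ uI uJ) I∩J≡0)
      fᶜᶜfᶜ≡0 : f ᶜ ᶜ * f ᶜ ≡ 0#
      fᶜᶜfᶜ≡0 = ᶜ*idempotent≈0 (f ᶜ) (ᶜ-idempotent f (unit-idempotent uJ))

    noWalk<2 : IsIdeal I → I ≢ J → ¬ SumIsWhole I J → ∀ k → k ℕ.< 2 → ¬ Walk I J k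
    noWalk<2 _   I≢I _      0 _ here = I≢I refl
    noWalk<2 idI _   ¬whole 1 _ (step (idJ , _) I~J here) = ¬whole (adjacent⇒sumIsWhole idI idJ I~J)
    noWalk<2 _   _   _      (suc (suc _)) (ℕ.s≤s (ℕ.s≤s ()))

    sumIsWhole⇒walk₁ : Vertex J → I ≢ J → SumIsWhole I J → Walk I J 1
    sumIsWhole⇒walk₁ vJ I≢J whole = step vJ (I≢J , sumIsWhole⇒essential whole) here

    distance-characterisation : Vertex I → Vertex J → I ≢ J →
      (Dist I J 2 ⇔ (¬ SumIsWhole I J × IntersectionNonzero I J)) ×
      (Dist I J 3 ⇔ (¬ SumIsWhole I J × IntersectionZero I J))
    distance-characterisation {I} {J} vI@(idI , _) vJ@(idJ , _) I≢J = mk⇔ d₂⇒ ⇒d₂ , mk⇔ d₃⇒ ⇒d₃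
      where
      dist⇒¬sumIsWhole : ∀ {k} → Dist I J k → 1 ℕ.< k → ¬ SumIsWhole I J
      dist⇒¬sumIsWhole (_ , minimal) 1<k whole = minimal 1 1<k (sumIsWhole⇒walk₁ vJ I≢J whole)
      d₂⇒ : Dist I J 2 → ¬ SumIsWhole I J × IntersectionNonzero I J
      d₂⇒ d₂@(walk , _) = dist⇒¬sumIsWhole d₂ ℕ.≤-refl ,
        [ (λ I∩J≡0 → contradiction walk (intersectionZero⇒¬walk₂ idI idJ I∩J≡0)) , id ]′
        (intersectionZero⊎Nonzero idI idJ)
      ⇒d₂ : ¬ SumIsWhole I J × IntersectionNonzero I J → Dist I J 2
      ⇒d₂ (¬whole , I∩J≢0) = intersectionNonzero⇒walk₂ vI vJ I∩J≢0 , noWalk<2 idI I≢J ¬whole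
      d₃⇒ : Dist I J 3 → ¬ SumIsWhole I J × IntersectionZero I J
      d₃⇒ d₃@(_ , minimal) = dist⇒¬sumIsWhole d₃ (ℕ.s≤s (ℕ.s≤s ℕ.z≤n)) ,
        [ id , (λ I∩J≢0 → contradiction (intersectionNonzero⇒walk₂ vI vJ I∩J≢0) (minimal 2 ℕ.≤-refl)) ]′
        (intersectionZero⊎Nonzero idI idJ)
      ⇒d₃ : ¬ SumIsWhole I J × IntersectionZero I J → Dist I J 3
      ⇒d₃ (¬whole , I∩J≡0) = intersectionZero⇒walk₃ vI vJ I∩J≡0 , noWalk<3
        where
        noWalk<3 : ∀ k → k ℕ.< 3 → ¬ Walk I J k
        noWalk<3 k k<3 with ℕ.m<1+n⇒m<n∨m≡n k<3
        ... | inj₁ k<2  = noWalk<2 idI I≢J ¬whole k k<2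
        ... | inj₂ refl = intersectionZero⇒¬walk₂ idI idJ I∩J≡0

mainTheorem5 : (n : ℕ) → SquarefreeProduct n →
    (I J : Subset n) → Vertex I → Vertex J → I ≢ J →
    (Dist I J 2 ⇔ (¬ SumIsWhole I J × IntersectionNonzero I J))
    × (Dist I J 3 ⇔ (¬ SumIsWhole I J × IntersectionZero I J))
mainTheorem5 zero (ps , ps-prime , _ , 0≡∏ps) =
  contradiction (sym 0≡∏ps) (ℕ.≢-nonZero⁻¹ (product ps) {{productOfPrimes≢0 ps-prime}})
mainTheorem5 (suc m) (ps , ps-prime , ps-unique , n≡∏ps) I J =
  IdealGraph.distance-characterisation m (Modular.squareFree⇒regular m squareFree) {I} {J}
  where
  squareFree : SquareFree (suc m)
  squareFree = subst SquareFree (sym n≡∏ps) (product-squareFree ps-prime ps-unique)
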